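{- For a positive integer $n$, the cyclomatic number of $A(n)$ equals $1$ (equivalently, the fundamental group of $A(n)$ is isomorphic to $\mathbb{Z}$) if and only if $$n\in\{\,2^{\ell}(12\pm 1)-1 \;:\; \ell\geq 0\,\}.$$ Consequently every graph $A(n)$ whose fundamental group is $\mathbb{Z}$ is isomorphic to $A(10)$ or to $A(12)$.
   Context: A hyperbinary expansion of a positive integer $n$ is a word $x_1\cdots x_k$ over the alphabet $\{0,1,2\}$ with $x_1\neq 0$ and $n=\sum_{i=1}^k x_i2^{k-i}$; $\mathcal H(n)$ denotes the set of hyperbinary expansions of $n$. Words are regarded up to leading zeros. Single-step reductions are: (I) $2\vec y \to 1\,0\,\vec y$; (II) $\vec x\,0\,2\,\vec y\to \vec x\,1\,0\,\vec y$; (III) $\vec x\,1\,2\,\vec y \twoheadrightarrow \vec x\,2\,0\,\vec y$, for words $\vec x,\vec y$ over $\{0,1,2\}$. If $\vec u$ is transformed into $\vec v$ by one single-step reduction, $\vec v$ is a child of $\vec u$. $A(n)$ is the directed graph with vertex set $\mathcal H(n)$ and an arc from $\vec u$ to $\vec v$ iff $\vec v$ is a child of $\vec u$; arcs from reductions of type I or II are coloured "$\to$", arcs from reductions of type III are coloured "$\twoheadrightarrow$". $A(n)$ is connected; its cyclomatic number is $|\text{arcs}|-|\text{vertices}|+1$, the rank of the free fundamental group of its underlying undirected graph. -}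

module Defs where

open import Data.Nat using (ℕ; zero; suc; _+_; _*_; _^_)
open import Data.Integer as ℤ using (ℤ; +_)
open import Data.List using (List; []; _∷_; _++_; foldl; length)
open import Data.List.Membership.Propositional using (_∈_)
open import Data.List.Relation.Unary.Unique.Propositional using (Unique)
open import Data.Product using (Σ; ∃; _×_; _,_)
open import Data.Sum using (_⊎_)
open import Data.Empty using (⊥)
open import Function.Bundles using (_⇔_)
open import Relation.Binary.PropositionalEquality using (_≡_; _≢_)

data Digit : Set where
  d0 d1 d2 : Digit

digitVal : Digit → ℕ
digitVal d0 = 0
digitVal d1 = 1
digitVal d2 = 2

-- Words over {0,1,2}; the first list element is the most significant digit x₁.
Word : Set
Word = List Digit

val : Word → ℕ
val = foldl (λ acc d → 2 * acc + digitVal d) 0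

LeadingNonzero : Word → Set
LeadingNonzero []       = ⊥
LeadingNonzero (d ∷ _)  = d ≢ d0

-- w ∈ ℋ(n): hyperbinary expansion of n (canonical representative, no leading zeros)
Hyp : ℕ → Word → Set
Hyp n w = LeadingNonzero w × val w ≡ n

data Colour : Set where
  single double : Colour

data Red : Colour → Word → Word → Set where
  redI   : ∀ y   → Red single (d2 ∷ y) (d1 ∷ d0 ∷ y)
  redII  : ∀ x y → Red single (x ++ d0 ∷ d2 ∷ y) (x ++ d1 ∷ d0 ∷ y)
  redIII : ∀ x y → Red double (x ++ d1 ∷ d2 ∷ y) (x ++ d2 ∷ d0 ∷ y)

Child : Word → Word → Set
Child u v = Σ Colour λ c → Red c u v

Arc : ℕ → Word × Word → Set
Arc n (u , v) = Hyp n u × Hyp n v × Child u v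

HasSize : {A : Set} → (A → Set) → ℕ → Set
HasSize {A} P k =
  Σ (List A) λ l → Unique l × (∀ x → P x ⇔ (x ∈ l)) × length l ≡ k

IsCyclomatic : ℕ → ℤ → Set
IsCyclomatic n c =
  Σ ℕ λ V → Σ ℕ λ E →
    HasSize (Hyp n) V × HasSize (Arc n) E ×
    c ≡ (+ E ℤ.- + V) ℤ.+ + 1

record Iso (n m : ℕ) : Set where
  field
    to       : Word → Word
    from     : Word → Word
    to-hyp   : ∀ u → Hyp n u → Hyp m (to u)
    from-hyp : ∀ v → Hyp m v → Hyp n (from v)
    from-to  : ∀ u → Hyp n u → from (to u) ≡ u
    to-from  : ∀ v → Hyp m v → to (from v) ≡ v
    arcs     : ∀ u v → Hyp n u → Hyp n v → ∀ c → Red c u v ⇔ Red c (to u) (to v)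

-- the set { 2^ℓ (12 ± 1) - 1 : ℓ ≥ 0 }, written as n + 1 = 2^ℓ·11 or n + 1 = 2^ℓ·13
InFamily : ℕ → Set
InFamily n = ∃ λ ℓ → (n + 1 ≡ 2 ^ ℓ * 11) ⊎ (n + 1 ≡ 2 ^ ℓ * 13)

module Submission where

-- Appending a digit d to a word u gives a word of value d + 2·val u, and a reduction of u d
-- either is a reduction of u with d kept, or (when d = 2) consumes that final 2:
-- 2 → 10, x02 → x10, x12 → x20.  Hence ℋ(2m+1) = ℋ(m)·1 and A(2m+1) ≅ A(m), while A(2m+2) is
-- a copy of A(m+1)·0 and of A(m)·2 joined by one extra arc for each expansion of m not ending
-- in 2; there are X(m) = |ℋ(k)| such expansions for m = 2k+1 and |ℋ(k+1)| for m = 2k+2.  So the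
-- cyclomatic number satisfies c(0) = 0, c(2m+1) = c(m), c(2m+2) = c(m+1) + c(m) + X(m) − 1.
-- Since |ℋ(k)| = 1 only when k+1 is a power of two and |ℋ(k)| = 2 only when k+1 = 3·2^a,
-- strong induction along this recursion shows that c(n) = 1 exactly when the odd part of n+1
-- is 11 or 13, and along the same descent A(n) ≅ A(10) or A(12).

open import Defs
open import Data.Nat as ℕ using (ℕ; zero; suc; pred; _+_; _*_; _^_; _<_; _≥_; s≤s; z≤n; z<s; >-nonZero)
open import Data.Nat.Properties
  using ( suc-injective; +-comm; *-suc; *-assoc; *-identityˡ; *-cancelˡ-≡; even≢odd; suc-pred
        ; ≤-trans; m≤m+n; m≤n+m; m≤n⇒m≤1+n; m+n≡0⇒m≡0; m+n≡0⇒n≡0; m*n≡0⇒m≡0; m^n≡0⇒m≡0)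
open import Data.Nat.Induction using (<-rec)
open import Data.Nat.Tactic.RingSolver using (solve-∀)
open import Data.Nat.Binary as ℕᵇ using (ℕᵇ; 2[1+_]; 1+[2_]; fromℕ)
open import Data.Nat.Binary.Properties using (toℕ-injective; toℕ-fromℕ; toℕ-suc)
open import Data.Integer as ℤ using (ℤ; +_)
open import Data.Integer.Properties using (pos-+; +-injective)
import Data.Integer.Tactic.RingSolver as ℤ-Solver
open import Data.List
  using ([]; _∷_; _++_; _∷ʳ_; map; foldl; reverse; drop; InitLast; initLast; _∷ʳ′_)
open import Data.List.Properties
  using ( length-++; length-map; foldl-∷ʳ; ++-assoc; ++-conicalʳ; ∷-injective
        ; ∷ʳ-injective; ∷ʳ-injectiveˡ; ∷ʳ-injectiveʳ; reverse-++; reverse-involutive)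
open import Data.List.Membership.Propositional using (_∈_)
open import Data.List.Membership.Propositional.Properties using (∈-++⁺ˡ; ∈-++⁺ʳ; ∈-++⁻; ∈-map⁺; ∈-map⁻)
open import Data.List.Membership.Propositional.Properties.WithK using (unique∧set⇒bag)
open import Data.List.Relation.Binary.BagAndSetEquality using (∼bag⇒↭)
open import Data.List.Relation.Binary.Permutation.Propositional.Properties using (↭-length)
import Data.List.Relation.Unary.Unique.Propositional.Properties as Unique
open import Data.List.Relation.Unary.Any using (here)
open import Data.List.Relation.Unary.AllPairs using ([]; _∷_)
open import Data.List.Relation.Unary.All using ([])
open import Data.Product using (∃; _×_; _,_; proj₁; proj₂)
open import Data.Sum as Sum using (_⊎_; inj₁; inj₂; [_,_])
open import Data.Unit using (⊤; tt)
open import Data.Empty using (⊥; ⊥-elim)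
open import Function.Base using (id; _∘_)
open import Function.Bundles using (_⇔_; mk⇔; Equivalence)
import Function.Properties.Equivalence as ⇔
open import Relation.Binary.PropositionalEquality
  using (_≡_; _≢_; refl; sym; trans; cong; cong₂; subst; subst₂; module ≡-Reasoning)

open Equivalence using (to; from)

-- Finite cardinalities

module _ {A : Set} where

  HasSize-unique : ∀ {P : A → Set} {a b} → HasSize P a → HasSize P b → a ≡ b
  HasSize-unique (l , !l , l≈P , refl) (m , !m , m≈P , refl) =
    ↭-length (∼bag⇒↭ (unique∧set⇒bag !l !m λ {x} →
      mk⇔ (to (m≈P x) ∘ from (l≈P x)) (to (l≈P x) ∘ from (m≈P x))))

  HasSize-cong : ∀ {P Q : A → Set} {a} → (∀ x → P x ⇔ Q x) → HasSize P a → HasSize Q a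
  HasSize-cong P⇔Q (l , !l , l≈P , |l|) =
    l , !l , (λ x → mk⇔ (to (l≈P x) ∘ from (P⇔Q x)) (to (P⇔Q x) ∘ from (l≈P x))) , |l|

  HasSize-⊎ : ∀ {P Q : A → Set} {a b} → (∀ x → P x → Q x → ⊥) →
              HasSize P a → HasSize Q b → HasSize (λ x → P x ⊎ Q x) (a + b)
  HasSize-⊎ {P} {Q} disjoint (l , !l , l≈P , refl) (m , !m , m≈Q , refl) =
    l ++ m , Unique.++⁺ !l !m (λ (x∈l , x∈m) → disjoint _ (from (l≈P _) x∈l) (from (m≈Q _) x∈m)) ,
    (λ x → mk⇔ [ ∈-++⁺ˡ ∘ to (l≈P x) , ∈-++⁺ʳ l ∘ to (m≈Q x) ] (fromList x)) , length-++ l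
    where
    fromList : ∀ x → x ∈ l ++ m → P x ⊎ Q x
    fromList x x∈l++m with ∈-++⁻ l x∈l++m
    ... | inj₁ x∈l = inj₁ (from (l≈P x) x∈l)
    ... | inj₂ x∈m = inj₂ (from (m≈Q x) x∈m)

  HasSize-≡ : (a : A) → HasSize (_≡ a) 1
  HasSize-≡ a = a ∷ [] , [] ∷ [] , (λ x → mk⇔ (λ { refl → here refl }) (λ { (here x≡a) → x≡a })) , refl

  HasSize-⊥ : HasSize {A} (λ _ → ⊥) 0
  HasSize-⊥ = [] , [] , (λ x → mk⇔ (λ ()) (λ ())) , refl

Image : ∀ {A B : Set} → (A → B) → (A → Set) → B → Set
Image f P y = ∃ λ x → P x × y ≡ f x

HasSize-Image : ∀ {A B : Set} {P : A → Set} {a} (f : A → B) → (∀ {x y} → f x ≡ f y → x ≡ y) →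
                HasSize P a → HasSize (Image f P) a
HasSize-Image {P = P} f f-injective (l , !l , l≈P , refl) =
  map f l , Unique.map⁺ f-injective !l , (λ y → mk⇔ toList (fromList y)) , length-map f l
  where
  toList : ∀ {y} → Image f P y → y ∈ map f l
  toList (x , Px , refl) = ∈-map⁺ f (to (l≈P x) Px)
  fromList : ∀ y → y ∈ map f l → Image f P y
  fromList y y∈fl with ∈-map⁻ f y∈fl
  ... | x , x∈l , y≡fx = x , from (l≈P x) x∈l , y≡fx

-- Recursion and induction along n = 0, 1 + 2m, 2 + 2m

data Binary : ℕ → Set where
  zero : Binary 0
  1+2* : ∀ m → Binary (1 + 2 * m)
  2+2* : ∀ m → Binary (2 + 2 * m)

binary : ∀ n → Binary n
binary zero = zero
binary (suc n) with binary n
... | zero = 1+2* 0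
... | 1+2* m = 2+2* m
... | 2+2* m = subst Binary (cong suc (*-suc 2 m)) (1+2* (suc m))

binaryInduction : (P : ℕ → Set) → P 0 → (∀ m → P m → P (1 + 2 * m)) →
                  (∀ m → P (1 + m) → P m → P (2 + 2 * m)) → ∀ n → P n
binaryInduction P P0 P-odd P-even = <-rec P step
  where
  step : ∀ n → (∀ {k} → k < n → P k) → P n
  step n ih with binary n
  ... | zero = P0
  ... | 1+2* m = P-odd m (ih (s≤s (m≤m+n m _)))
  ... | 2+2* m = P-even m (ih (s≤s (s≤s (m≤m+n m _)))) (ih (s≤s (m≤n⇒m≤1+n (m≤m+n m _))))

module _ {A : Set} (z : A) (odd : A → A) (even : A → A → A) where

  -- the pair (f b , f (b + 1)) is structurally recursive on the binary numeral b
  private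
    pairs : ℕᵇ → A × A
    pairs ℕᵇ.zero = z , odd z
    pairs 1+[2 b ] = odd (proj₁ (pairs b)) , even (proj₂ (pairs b)) (proj₁ (pairs b))
    pairs 2[1+ b ] = even (proj₂ (pairs b)) (proj₁ (pairs b)) , odd (proj₂ (pairs b))

    pairs-suc : ∀ b → proj₂ (pairs b) ≡ proj₁ (pairs (ℕᵇ.suc b))
    pairs-suc ℕᵇ.zero = refl
    pairs-suc 1+[2 b ] = refl
    pairs-suc 2[1+ b ] = cong odd (pairs-suc b)

    fromℕ-suc : ∀ n → fromℕ (suc n) ≡ ℕᵇ.suc (fromℕ n)
    fromℕ-suc n = toℕ-injective (trans (toℕ-fromℕ (suc n))
                    (sym (trans (toℕ-suc (fromℕ n)) (cong suc (toℕ-fromℕ n)))))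

    fromℕ-1+2* : ∀ m → fromℕ (1 + 2 * m) ≡ 1+[2 fromℕ m ]
    fromℕ-1+2* m = toℕ-injective (trans (toℕ-fromℕ _) (cong (λ k → 1 + 2 * k) (sym (toℕ-fromℕ m))))

    fromℕ-2+2* : ∀ m → fromℕ (2 + 2 * m) ≡ 2[1+ fromℕ m ]
    fromℕ-2+2* m = toℕ-injective (trans (toℕ-fromℕ _)
                     (trans (sym (*-suc 2 m)) (cong (λ k → 2 * suc k) (sym (toℕ-fromℕ m)))))

  binaryRec : ℕ → A
  binaryRec n = proj₁ (pairs (fromℕ n))

  binaryRec-1+2* : ∀ m → binaryRec (1 + 2 * m) ≡ odd (binaryRec m)
  binaryRec-1+2* m = cong (proj₁ ∘ pairs) (fromℕ-1+2* m)

  binaryRec-2+2* : ∀ m → binaryRec (2 + 2 * m) ≡ even (binaryRec (1 + m)) (binaryRec m)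
  binaryRec-2+2* m = begin
    proj₁ (pairs (fromℕ (2 + 2 * m)))                            ≡⟨ cong (proj₁ ∘ pairs) (fromℕ-2+2* m) ⟩
    even (proj₂ (pairs (fromℕ m))) (binaryRec m)                 ≡⟨ cong (λ x → even x (binaryRec m)) (pairs-suc (fromℕ m)) ⟩
    even (proj₁ (pairs (ℕᵇ.suc (fromℕ m)))) (binaryRec m)        ≡⟨ cong (λ b → even (proj₁ (pairs b)) (binaryRec m)) (sym (fromℕ-suc m)) ⟩
    even (binaryRec (1 + m)) (binaryRec m)                       ∎
    where open ≡-Reasoning

-- Odd parts

2*-injective : ∀ {a b} → 2 * a ≡ 2 * b → a ≡ b
2*-injective {a} {b} = *-cancelˡ-≡ a b 2

data OddPart (N q : ℕ) : Set where
  oddPart : ∀ ℓ → N ≡ 2 ^ ℓ * (1 + 2 * q) → OddPart N q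

Family : ℕ → Set
Family N = OddPart N 5 ⊎ OddPart N 6

private
  2^suc* : ∀ ℓ x → 2 ^ suc ℓ * x ≡ 2 * (2 ^ ℓ * x)
  2^suc* ℓ x = *-assoc 2 (2 ^ ℓ) x

2^*odd-injective : ∀ a b {q r} → 2 ^ a * (1 + 2 * q) ≡ 2 ^ b * (1 + 2 * r) → q ≡ r
2^*odd-injective zero zero {q} {r} eq =
  2*-injective (suc-injective (trans (sym (*-identityˡ _)) (trans eq (*-identityˡ _))))
2^*odd-injective zero (suc b) {q} {r} eq =
  ⊥-elim (even≢odd (2 ^ b * (1 + 2 * r)) q (sym (trans (sym (*-identityˡ _)) (trans eq (2^suc* b _)))))
2^*odd-injective (suc a) zero {q} {r} eq =
  ⊥-elim (even≢odd (2 ^ a * (1 + 2 * q)) r (trans (sym (2^suc* a _)) (trans eq (*-identityˡ _))))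
2^*odd-injective (suc a) (suc b) eq =
  2^*odd-injective a b (2*-injective (trans (sym (2^suc* a _)) (trans eq (2^suc* b _))))

oddPart-unique : ∀ {N q r} → OddPart N q → OddPart N r → q ≡ r
oddPart-unique (oddPart a refl) (oddPart b eq) = 2^*odd-injective a b eq

oddPart-self : ∀ q → OddPart (1 + 2 * q) q
oddPart-self q = oddPart 0 (sym (*-identityˡ _))

oddPart-1+2* : ∀ {k q} → OddPart (1 + 2 * k) q → k ≡ q
oddPart-1+2* {k} = oddPart-unique (oddPart-self k)

oddPart-2* : ∀ {N q} → OddPart N q → OddPart (2 * N) q
oddPart-2* (oddPart ℓ refl) = oddPart (suc ℓ) (sym (2^suc* ℓ _))

oddPart-2*⁻ : ∀ {N q} → OddPart (2 * N) q → OddPart N q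
oddPart-2*⁻ {N} {q} (oddPart zero eq) = ⊥-elim (even≢odd N q (trans eq (*-identityˡ _)))
oddPart-2*⁻ (oddPart (suc ℓ) eq) = oddPart ℓ (2*-injective (trans eq (2^suc* ℓ _)))

oddPart-0 : ∀ {q} → OddPart 0 q → ⊥
oddPart-0 (oddPart ℓ eq) with () ← m^n≡0⇒m≡0 2 ℓ (m*n≡0⇒m≡0 (2 ^ ℓ) _ (sym eq))

-- Of two consecutive numbers one is odd, hence its own odd part.
oddPart-neighbours : ∀ {N q r} → OddPart N q → OddPart (suc N) r →
                     (N ≡ 1 + 2 * q × OddPart (1 + q) r) ⊎ (suc N ≡ 1 + 2 * r × OddPart r q)
oddPart-neighbours {N} {q} {r} oN oN+1 with binary N
... | zero = ⊥-elim (oddPart-0 oN)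
... | 1+2* k with refl ← oddPart-1+2* {k} {q} oN =
  inj₁ (refl , oddPart-2*⁻ (subst (λ x → OddPart x r) (sym (*-suc 2 k)) oN+1))
... | 2+2* k with refl ← oddPart-1+2* {suc k} {r} (subst (λ x → OddPart x r) (sym (cong suc (*-suc 2 k))) oN+1) =
  inj₂ (sym (cong suc (*-suc 2 k)) , oddPart-2*⁻ (subst (λ x → OddPart x q) (sym (*-suc 2 k)) oN))

family-2* : ∀ {N} → Family N → Family (2 * N)
family-2* (inj₁ o) = inj₁ (oddPart-2* o)
family-2* (inj₂ o) = inj₂ (oddPart-2* o)

family-2*⁻ : ∀ {N} → Family (2 * N) → Family N
family-2*⁻ (inj₁ o) = inj₁ (oddPart-2*⁻ o)
family-2*⁻ (inj₂ o) = inj₂ (oddPart-2*⁻ o)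

family-not-pow2 : ∀ {N} → Family N → OddPart N 0 → ⊥
family-not-pow2 (inj₁ o) p with () ← oddPart-unique o p
family-not-pow2 (inj₂ o) p with () ← oddPart-unique o p

private
  oddPart-6 : ∀ {q} → OddPart 6 q → 1 ≡ q
  oddPart-6 = oddPart-unique (oddPart 1 refl)

family-pred-not-pow2 : ∀ {N} → OddPart N 0 → Family (suc N) → ⊥
family-pred-not-pow2 p (inj₁ o) with oddPart-neighbours p o
... | inj₁ (_ , o′) with () ← oddPart-1+2* {0} o′
... | inj₂ (_ , o′) with () ← oddPart-1+2* {2} o′
family-pred-not-pow2 p (inj₂ o) with oddPart-neighbours p o
... | inj₁ (_ , o′) with () ← oddPart-1+2* {0} o′
... | inj₂ (_ , o′) with () ← oddPart-6 o′

family-suc-not-pow2 : ∀ {N} → Family N → OddPart (suc N) 0 → ⊥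
family-suc-not-pow2 (inj₁ o) p with oddPart-neighbours o p
... | inj₁ (_ , o′) with () ← oddPart-6 o′
... | inj₂ (_ , o′) = oddPart-0 o′
family-suc-not-pow2 (inj₂ o) p with oddPart-neighbours o p
... | inj₁ (_ , o′) with () ← oddPart-1+2* {3} o′
... | inj₂ (_ , o′) = oddPart-0 o′

oddPart-3-below-pow2 : ∀ {N} → OddPart N 1 → OddPart (suc N) 0 → N ≡ 3
oddPart-3-below-pow2 o p with oddPart-neighbours o p
... | inj₁ (N≡3 , _) = N≡3
... | inj₂ (_ , o′) = ⊥-elim (oddPart-0 o′)

pow2-below-oddPart-3 : ∀ {N} → OddPart N 0 → OddPart (suc N) 1 → N ≡ 2
pow2-below-oddPart-3 p o with oddPart-neighbours p o
... | inj₁ (_ , o′) with () ← oddPart-1+2* {0} o′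
... | inj₂ (N+1≡3 , _) = suc-injective N+1≡3

-- Appending a digit

NoLeadingZero : Word → Set
NoLeadingZero []      = ⊤
NoLeadingZero (d ∷ _) = d ≢ d0

-- ℋ(n), extended by the empty word as the expansion of 0
Expansion : ℕ → Word → Set
Expansion n w = NoLeadingZero w × val w ≡ n

val-∷ʳ : ∀ u d → val (u ∷ʳ d) ≡ digitVal d + 2 * val u
val-∷ʳ u d = trans (foldl-∷ʳ _ 0 d u) (+-comm (2 * val u) (digitVal d))

noLeadingZero-∷ʳ⁻ : ∀ u {d} → NoLeadingZero (u ∷ʳ d) → NoLeadingZero u
noLeadingZero-∷ʳ⁻ []      _   = tt
noLeadingZero-∷ʳ⁻ (_ ∷ _) nlz = nlz

noLeadingZero-∷ʳ⁺ : ∀ u {d} → NoLeadingZero u → (u ≡ [] → d ≢ d0) → NoLeadingZero (u ∷ʳ d)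
noLeadingZero-∷ʳ⁺ []      _   d≢0 = d≢0 refl
noLeadingZero-∷ʳ⁺ (_ ∷ _) nlz _   = nlz

horner-≡0 : ∀ a w → foldl (λ acc d → 2 * acc + digitVal d) a w ≡ 0 → a ≡ 0
horner-≡0 a []      eq = eq
horner-≡0 a (d ∷ w) eq = m+n≡0⇒m≡0 a (m+n≡0⇒m≡0 (2 * a) (horner-≡0 _ w eq))

expansion-0 : ∀ {w} → Expansion 0 w → w ≡ []
expansion-0 {[]}     _           = refl
expansion-0 {d ∷ w} (d≢0 , val≡0) with d | horner-≡0 (digitVal d) w val≡0
... | d0 | _ = ⊥-elim (d≢0 refl)

expansion-∷ʳ⁺ : ∀ {k u} d → Expansion k u → (k ≡ 0 → d ≢ d0) → Expansion (digitVal d + 2 * k) (u ∷ʳ d)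
expansion-∷ʳ⁺ {u = u} d (nlz , refl) d≢0 =
  noLeadingZero-∷ʳ⁺ u nlz (λ u≡[] → d≢0 (cong val u≡[])) , val-∷ʳ u d

halve-odd : ∀ {a m} d → digitVal d + 2 * a ≡ 1 + 2 * m → d ≡ d1 × a ≡ m
halve-odd {a} {m} d0 eq = ⊥-elim (even≢odd a m eq)
halve-odd         d1 eq = refl , 2*-injective (suc-injective eq)
halve-odd {a} {m} d2 eq = ⊥-elim (even≢odd m a (sym (suc-injective eq)))

halve-even : ∀ {a m} d → digitVal d + 2 * a ≡ 2 + 2 * m → (d ≡ d0 × a ≡ 1 + m) ⊎ (d ≡ d2 × a ≡ m)
halve-even {a} {m} d0 eq = inj₁ (refl , 2*-injective (trans eq (sym (*-suc 2 m))))
halve-even {a} {m} d1 eq = ⊥-elim (even≢odd a m (suc-injective eq))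
halve-even         d2 eq = inj₂ (refl , 2*-injective (suc-injective (suc-injective eq)))

expansion-1+2*-∷ʳ : ∀ {m u d} → Expansion (1 + 2 * m) (u ∷ʳ d) → d ≡ d1 × Expansion m u
expansion-1+2*-∷ʳ {u = u} {d} (nlz , eq) with halve-odd d (trans (sym (val-∷ʳ u d)) eq)
... | d≡1 , val≡m = d≡1 , noLeadingZero-∷ʳ⁻ u nlz , val≡m

expansion-2+2*-∷ʳ : ∀ {m u d} → Expansion (2 + 2 * m) (u ∷ʳ d) →
                    (d ≡ d0 × Expansion (1 + m) u) ⊎ (d ≡ d2 × Expansion m u)
expansion-2+2*-∷ʳ {u = u} {d} (nlz , eq) with halve-even d (trans (sym (val-∷ʳ u d)) eq)
... | inj₁ (d≡0 , val≡) = inj₁ (d≡0 , noLeadingZero-∷ʳ⁻ u nlz , val≡)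
... | inj₂ (d≡2 , val≡) = inj₂ (d≡2 , noLeadingZero-∷ʳ⁻ u nlz , val≡)

expansions-1+2* : ∀ m w → Expansion (1 + 2 * m) w ⇔ Image (_∷ʳ d1) (Expansion m) w
expansions-1+2* m w = mk⇔ (split w (initLast w)) λ { (u , e , refl) → expansion-∷ʳ⁺ d1 e (λ _ ()) }
  where
  split : ∀ w → InitLast w → Expansion (1 + 2 * m) w → Image (_∷ʳ d1) (Expansion m) w
  split .[] [] (_ , ())
  split .(u ∷ʳ d) (u ∷ʳ′ d) e with expansion-1+2*-∷ʳ {m} e
  ... | refl , e′ = u , e′ , refl

expansions-2+2* : ∀ m w → Expansion (2 + 2 * m) w ⇔
                  (Image (_∷ʳ d0) (Expansion (1 + m)) w ⊎ Image (_∷ʳ d2) (Expansion m) w)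
expansions-2+2* m w = mk⇔ (split w (initLast w)) join
  where
  split : ∀ w → InitLast w → Expansion (2 + 2 * m) w →
          Image (_∷ʳ d0) (Expansion (1 + m)) w ⊎ Image (_∷ʳ d2) (Expansion m) w
  split .[] [] (_ , ())
  split .(u ∷ʳ d) (u ∷ʳ′ d) e with expansion-2+2*-∷ʳ {m} e
  ... | inj₁ (refl , e′) = inj₁ (u , e′ , refl)
  ... | inj₂ (refl , e′) = inj₂ (u , e′ , refl)
  join : Image (_∷ʳ d0) (Expansion (1 + m)) w ⊎ Image (_∷ʳ d2) (Expansion m) w → Expansion (2 + 2 * m) w
  join (inj₁ (u , e , refl)) with nlz , eq ← expansion-∷ʳ⁺ d0 e (λ ()) = nlz , trans eq (*-suc 2 m)
  join (inj₂ (u , e , refl)) = expansion-∷ʳ⁺ d2 e (λ _ ())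

data Bump : Word → Word → Set where
  []  : Bump [] (d1 ∷ [])
  0↑1 : ∀ x → Bump (x ∷ʳ d0) (x ∷ʳ d1)
  1↑2 : ∀ x → Bump (x ∷ʳ d1) (x ∷ʳ d2)

private
  ∷ʳ-∷ʳ : ∀ (x : Word) a b → x ∷ʳ a ∷ʳ b ≡ x ++ a ∷ b ∷ []
  ∷ʳ-∷ʳ x a b = ++-assoc x (a ∷ []) (b ∷ [])

  ++-∷-∷-∷ʳ : ∀ (x : Word) a b y d → x ++ a ∷ b ∷ y ∷ʳ d ≡ (x ++ a ∷ b ∷ y) ∷ʳ d
  ++-∷-∷-∷ʳ x a b y d = sym (++-assoc x (a ∷ b ∷ y) (d ∷ []))

red-∷ʳ : ∀ {c u v} d → Red c u v → Red c (u ∷ʳ d) (v ∷ʳ d)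
red-∷ʳ d (redI y)     = redI (y ∷ʳ d)
red-∷ʳ d (redII x y)  = subst₂ (Red single) (++-∷-∷-∷ʳ x d0 d2 y d) (++-∷-∷-∷ʳ x d1 d0 y d) (redII x (y ∷ʳ d))
red-∷ʳ d (redIII x y) = subst₂ (Red double) (++-∷-∷-∷ʳ x d1 d2 y d) (++-∷-∷-∷ʳ x d2 d0 y d) (redIII x (y ∷ʳ d))

bump-child : ∀ {u u⁺} → Bump u u⁺ → Child (u ∷ʳ d2) (u⁺ ∷ʳ d0)
bump-child []      = single , redI []
bump-child (0↑1 x) = single , subst₂ (Red single) (sym (∷ʳ-∷ʳ x d0 d2)) (sym (∷ʳ-∷ʳ x d1 d0)) (redII x [])
bump-child (1↑2 x) = double , subst₂ (Red double) (sym (∷ʳ-∷ʳ x d1 d2)) (sym (∷ʳ-∷ʳ x d2 d0)) (redIII x [])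

∷ʳ-factor : ∀ {u d} x a b {y} → InitLast y → u ∷ʳ d ≡ x ++ a ∷ b ∷ y →
            (y ≡ [] × u ≡ x ∷ʳ a × d ≡ b) ⊎ (∃ λ y′ → y ≡ y′ ∷ʳ d × u ≡ x ++ a ∷ b ∷ y′)
∷ʳ-factor {u} x a b [] eq with refl , refl ← ∷ʳ-injective u (x ∷ʳ a) (trans eq (sym (∷ʳ-∷ʳ x a b))) =
  inj₁ (refl , refl , refl)
∷ʳ-factor {u} x a b (y′ ∷ʳ′ e) eq with refl , refl ← ∷ʳ-injective u _ (trans eq (++-∷-∷-∷ʳ x a b y′ e)) =
  inj₂ (y′ , refl , refl)

red-∷ʳ⁻ : ∀ {c s w} u d → Red c s w → s ≡ u ∷ʳ d →
          (∃ λ v → w ≡ v ∷ʳ d × Red c u v) ⊎ (d ≡ d2 × ∃ λ u⁺ → Bump u u⁺ × w ≡ u⁺ ∷ʳ d0)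
red-∷ʳ⁻ [] d (redI y) eq with refl , refl ← ∷-injective eq = inj₂ (refl , _ , [] , refl)
red-∷ʳ⁻ (a ∷ u) d (redI y) eq with refl , refl ← ∷-injective eq = inj₁ (_ , refl , redI u)
red-∷ʳ⁻ u d (redII x y) eq with ∷ʳ-factor x d0 d2 (initLast y) (sym eq)
... | inj₁ (refl , refl , refl) = inj₂ (refl , _ , 0↑1 x , sym (∷ʳ-∷ʳ x d1 d0))
... | inj₂ (y′ , refl , refl)   = inj₁ (_ , ++-∷-∷-∷ʳ x d1 d0 y′ d , redII x y′)
red-∷ʳ⁻ u d (redIII x y) eq with ∷ʳ-factor x d1 d2 (initLast y) (sym eq)
... | inj₁ (refl , refl , refl) = inj₂ (refl , _ , 1↑2 x , sym (∷ʳ-∷ʳ x d2 d0))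
... | inj₂ (y′ , refl , refl)   = inj₁ (_ , ++-∷-∷-∷ʳ x d2 d0 y′ d , redIII x y′)

red-∷ʳ⇔ : ∀ {c u v d} → d ≢ d2 → Red c (u ∷ʳ d) (v ∷ʳ d) ⇔ Red c u v
red-∷ʳ⇔ {u = u} {v} {d} d≢2 = mk⇔ strip (red-∷ʳ d)
  where
  strip : ∀ {c} → Red c (u ∷ʳ d) (v ∷ʳ d) → Red c u v
  strip r with red-∷ʳ⁻ u d r refl
  ... | inj₁ (v′ , eq , r′) with refl ← ∷ʳ-injectiveˡ v v′ eq = r′
  ... | inj₂ (d≡2 , _) = ⊥-elim (d≢2 d≡2)

ExpansionArc : ℕ → Word × Word → Set
ExpansionArc n (u , v) = Expansion n u × Expansion n v × Child u v

-- the arcs of A(2m + 2) that consume the final digit 2 of their source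
CrossArc : ℕ → Word × Word → Set
CrossArc m p = ∃ λ u → Expansion m u × ∃ λ u⁺ → Bump u u⁺ × p ≡ (u ∷ʳ d2 , u⁺ ∷ʳ d0)

appendBoth : Digit → Word × Word → Word × Word
appendBoth d (u , v) = u ∷ʳ d , v ∷ʳ d

bump-expansion : ∀ {m u u⁺} → Bump u u⁺ → Expansion m u → Expansion (1 + m) u⁺
bump-expansion []      (_ , refl)   = (λ ()) , refl
bump-expansion (0↑1 x) (nlz , refl) =
  noLeadingZero-∷ʳ⁺ x (noLeadingZero-∷ʳ⁻ x nlz) (λ _ ()) , trans (val-∷ʳ x d1) (cong suc (sym (val-∷ʳ x d0)))
bump-expansion (1↑2 x) (nlz , refl) =
  noLeadingZero-∷ʳ⁺ x (noLeadingZero-∷ʳ⁻ x nlz) (λ _ ()) , trans (val-∷ʳ x d2) (cong suc (sym (val-∷ʳ x d1)))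

red-source-nonempty : ∀ {c u v} → Red c u v → u ≡ [] → ⊥
red-source-nonempty (redI _)           ()
red-source-nonempty (redII [] _)       ()
red-source-nonempty (redII (_ ∷ _) _)  ()
red-source-nonempty (redIII [] _)      ()
red-source-nonempty (redIII (_ ∷ _) _) ()

expansionArcs-0 : ∀ p → ExpansionArc 0 p → ⊥
expansionArcs-0 (u , v) (e , _ , _ , r) = red-source-nonempty r (expansion-0 e)

expansionArcs-1+2* : ∀ m p → ExpansionArc (1 + 2 * m) p ⇔ Image (appendBoth d1) (ExpansionArc m) p
expansionArcs-1+2* m p = mk⇔ (split p) λ { ((u , v) , (e , e′ , c , r) , refl) →
  from (expansions-1+2* m _) (u , e , refl) , from (expansions-1+2* m _) (v , e′ , refl) , c , red-∷ʳ d1 r }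
  where
  split : ∀ p → ExpansionArc (1 + 2 * m) p → Image (appendBoth d1) (ExpansionArc m) p
  split (w , w′) (e , e′ , c , r) with to (expansions-1+2* m w) e
  ... | u , eu , refl with red-∷ʳ⁻ u d1 r refl
  ... | inj₁ (v , refl , r′) = (u , v) , (eu , proj₂ (expansion-1+2*-∷ʳ {m} e′) , c , r′) , refl

expansionArcs-2+2* : ∀ m p → ExpansionArc (2 + 2 * m) p ⇔
  ((Image (appendBoth d0) (ExpansionArc (1 + m)) p ⊎ Image (appendBoth d2) (ExpansionArc m) p) ⊎ CrossArc m p)
expansionArcs-2+2* m p = mk⇔ (split p) join
  where
  expansion-∷ʳd0 : ∀ {u} → Expansion (1 + m) u → Expansion (2 + 2 * m) (u ∷ʳ d0)
  expansion-∷ʳd0 e = from (expansions-2+2* m _) (inj₁ (_ , e , refl))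
  expansion-∷ʳd2 : ∀ {u} → Expansion m u → Expansion (2 + 2 * m) (u ∷ʳ d2)
  expansion-∷ʳd2 e = from (expansions-2+2* m _) (inj₂ (_ , e , refl))

  split : ∀ p → ExpansionArc (2 + 2 * m) p →
    (Image (appendBoth d0) (ExpansionArc (1 + m)) p ⊎ Image (appendBoth d2) (ExpansionArc m) p) ⊎ CrossArc m p
  split (w , w′) (e , e′ , c , r) with to (expansions-2+2* m w) e
  ... | inj₁ (u , eu , refl) with red-∷ʳ⁻ u d0 r refl
  ...   | inj₁ (v , refl , r′) with expansion-2+2*-∷ʳ {m} e′
  ...     | inj₁ (_ , ev) = inj₁ (inj₁ ((u , v) , (eu , ev , c , r′) , refl))
  split (w , w′) (e , e′ , c , r) | inj₂ (u , eu , refl) with red-∷ʳ⁻ u d2 r refl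
  ...   | inj₂ (_ , u⁺ , b , refl) = inj₂ (u , eu , u⁺ , b , refl)
  ...   | inj₁ (v , refl , r′) with expansion-2+2*-∷ʳ {m} e′
  ...     | inj₂ (_ , ev) = inj₁ (inj₂ ((u , v) , (eu , ev , c , r′) , refl))

  join : (Image (appendBoth d0) (ExpansionArc (1 + m)) p ⊎ Image (appendBoth d2) (ExpansionArc m) p) ⊎ CrossArc m p →
         ExpansionArc (2 + 2 * m) p
  join (inj₁ (inj₁ (_ , (e , e′ , c , r) , refl))) = expansion-∷ʳd0 e , expansion-∷ʳd0 e′ , c , red-∷ʳ d0 r
  join (inj₁ (inj₂ (_ , (e , e′ , c , r) , refl))) = expansion-∷ʳd2 e , expansion-∷ʳd2 e′ , c , red-∷ʳ d2 r
  join (inj₂ (u , e , u⁺ , b , refl)) = expansion-∷ʳd2 e , expansion-∷ʳd0 (bump-expansion b e) , bump-child b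

crossArcs-0 : ∀ p → CrossArc 0 p ⇔ (p ≡ (d2 ∷ [] , d1 ∷ d0 ∷ []))
crossArcs-0 p = mk⇔ split λ { refl → [] , (tt , refl) , _ , [] , refl }
  where
  split : CrossArc 0 p → p ≡ (d2 ∷ [] , d1 ∷ d0 ∷ [])
  split (_ , _ , _ , []      , refl) = refl
  split (_ , e , _ , 0↑1 x   , _) with () ← ++-conicalʳ x _ (expansion-0 e)
  split (_ , e , _ , 1↑2 x   , _) with () ← ++-conicalʳ x _ (expansion-0 e)

crossArcs-1+2* : ∀ k p → CrossArc (1 + 2 * k) p ⇔ Image (λ x → x ∷ʳ d1 ∷ʳ d2 , x ∷ʳ d2 ∷ʳ d0) (Expansion k) p
crossArcs-1+2* k p = mk⇔ split λ { (x , e , refl) → x ∷ʳ d1 , expansion-∷ʳ⁺ d1 e (λ _ ()) , _ , 1↑2 x , refl }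
  where
  split : CrossArc (1 + 2 * k) p → Image (λ x → x ∷ʳ d1 ∷ʳ d2 , x ∷ʳ d2 ∷ʳ d0) (Expansion k) p
  split (_ , (_ , ()) , _ , [] , _)
  split (_ , e , _ , 0↑1 x , _) with () ← proj₁ (expansion-1+2*-∷ʳ {k} e)
  split (_ , e , _ , 1↑2 x , refl) = x , proj₂ (expansion-1+2*-∷ʳ {k} e) , refl

crossArcs-2+2* : ∀ k p → CrossArc (2 + 2 * k) p ⇔ Image (λ x → x ∷ʳ d0 ∷ʳ d2 , x ∷ʳ d1 ∷ʳ d0) (Expansion (1 + k)) p
crossArcs-2+2* k p = mk⇔ split λ { (x , e , refl) → x ∷ʳ d0 , from (expansions-2+2* k _) (inj₁ (x , e , refl)) , _ , 0↑1 x , refl }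
  where
  split : CrossArc (2 + 2 * k) p → Image (λ x → x ∷ʳ d0 ∷ʳ d2 , x ∷ʳ d1 ∷ʳ d0) (Expansion (1 + k)) p
  split (_ , (_ , ()) , _ , [] , _)
  split (_ , e , _ , 0↑1 x , refl) with expansion-2+2*-∷ʳ {k} e
  ... | inj₁ (_ , ex) = x , ex , refl
  split (_ , e , _ , 1↑2 x , _) with expansion-2+2*-∷ʳ {k} e
  ... | inj₁ (() , _)
  ... | inj₂ (() , _)

-- Counting vertices and arcs

-- crossings counts the cross arcs of A(2n + 2), i.e. the expansions of n not ending in 2.
record Census : Set where
  field
    vertices arcs crossings cycles : ℕ

module _ where
  open Census

  private
    base : Census
    base = record { vertices = 1 ; arcs = 0 ; crossings = 1 ; cycles = 0 }

    odd : Census → Census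
    odd c = record { vertices = vertices c ; arcs = arcs c ; crossings = vertices c ; cycles = cycles c }

    even : Census → Census → Census
    even c′ c = record
      { vertices  = vertices c′ + vertices c
      ; arcs      = arcs c′ + arcs c + crossings c
      ; crossings = vertices c′
      ; cycles    = cycles c′ + cycles c + pred (crossings c)
      }

  census : ℕ → Census
  census = binaryRec base odd even

  vertexCount arcCount crossCount cycleRank : ℕ → ℕ
  vertexCount = vertices ∘ census
  arcCount    = arcs ∘ census
  crossCount  = crossings ∘ census
  cycleRank   = cycles ∘ census

  private
    census-1+2* : ∀ m → census (1 + 2 * m) ≡ odd (census m)
    census-1+2* = binaryRec-1+2* base odd even

    census-2+2* : ∀ m → census (2 + 2 * m) ≡ even (census (1 + m)) (census m)
    census-2+2* = binaryRec-2+2* base odd even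

  vertexCount-1+2* : ∀ m → vertexCount (1 + 2 * m) ≡ vertexCount m
  vertexCount-1+2* m = cong vertices (census-1+2* m)

  vertexCount-2+2* : ∀ m → vertexCount (2 + 2 * m) ≡ vertexCount (1 + m) + vertexCount m
  vertexCount-2+2* m = cong vertices (census-2+2* m)

  arcCount-1+2* : ∀ m → arcCount (1 + 2 * m) ≡ arcCount m
  arcCount-1+2* m = cong arcs (census-1+2* m)

  arcCount-2+2* : ∀ m → arcCount (2 + 2 * m) ≡ arcCount (1 + m) + arcCount m + crossCount m
  arcCount-2+2* m = cong arcs (census-2+2* m)

  crossCount-1+2* : ∀ m → crossCount (1 + 2 * m) ≡ vertexCount m
  crossCount-1+2* m = cong crossings (census-1+2* m)

  crossCount-2+2* : ∀ m → crossCount (2 + 2 * m) ≡ vertexCount (1 + m)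
  crossCount-2+2* m = cong crossings (census-2+2* m)

  cycleRank-1+2* : ∀ m → cycleRank (1 + 2 * m) ≡ cycleRank m
  cycleRank-1+2* m = cong cycles (census-1+2* m)

  cycleRank-2+2* : ∀ m → cycleRank (2 + 2 * m) ≡ cycleRank (1 + m) + cycleRank m + pred (crossCount m)
  cycleRank-2+2* m = cong cycles (census-2+2* m)

appendBoth-injective : ∀ d {p q} → appendBoth d p ≡ appendBoth d q → p ≡ q
appendBoth-injective d {u , v} {u′ , v′} eq
  with refl ← ∷ʳ-injectiveˡ u u′ (cong proj₁ eq) | refl ← ∷ʳ-injectiveˡ v v′ (cong proj₂ eq) = refl

private
  d0≢d2 : d0 ≡ d2 → ⊥
  d0≢d2 ()

expansions-size : ∀ n → HasSize (Expansion n) (vertexCount n)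
expansions-size = binaryInduction _ size-0 size-1+2* size-2+2*
  where
  size-0 : HasSize (Expansion 0) 1
  size-0 = HasSize-cong (λ w → mk⇔ (λ { refl → tt , refl }) expansion-0) (HasSize-≡ [])

  size-1+2* : ∀ m → HasSize (Expansion m) (vertexCount m) → HasSize (Expansion (1 + 2 * m)) (vertexCount (1 + 2 * m))
  size-1+2* m size-m = subst (HasSize _) (sym (vertexCount-1+2* m))
    (HasSize-cong (λ w → ⇔.sym (expansions-1+2* m w)) (HasSize-Image (_∷ʳ d1) (∷ʳ-injectiveˡ _ _) size-m))

  size-2+2* : ∀ m → HasSize (Expansion (1 + m)) (vertexCount (1 + m)) → HasSize (Expansion m) (vertexCount m) →
              HasSize (Expansion (2 + 2 * m)) (vertexCount (2 + 2 * m))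
  size-2+2* m size-1+m size-m = subst (HasSize _) (sym (vertexCount-2+2* m))
    (HasSize-cong (λ w → ⇔.sym (expansions-2+2* m w))
      (HasSize-⊎ (λ { _ (_ , _ , refl) (_ , _ , eq) → d0≢d2 (∷ʳ-injectiveʳ _ _ eq) })
        (HasSize-Image (_∷ʳ d0) (∷ʳ-injectiveˡ _ _) size-1+m)
        (HasSize-Image (_∷ʳ d2) (∷ʳ-injectiveˡ _ _) size-m)))

crossArcs-size : ∀ m → HasSize (CrossArc m) (crossCount m)
crossArcs-size m with binary m
... | zero = HasSize-cong (λ p → ⇔.sym (crossArcs-0 p)) (HasSize-≡ _)
... | 1+2* k = subst (HasSize _) (sym (crossCount-1+2* k))
  (HasSize-cong (λ p → ⇔.sym (crossArcs-1+2* k p))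
    (HasSize-Image _ (∷ʳ-injectiveˡ _ _ ∘ ∷ʳ-injectiveˡ _ _ ∘ cong proj₁) (expansions-size k)))
... | 2+2* k = subst (HasSize _) (sym (crossCount-2+2* k))
  (HasSize-cong (λ p → ⇔.sym (crossArcs-2+2* k p))
    (HasSize-Image _ (∷ʳ-injectiveˡ _ _ ∘ ∷ʳ-injectiveˡ _ _ ∘ cong proj₁) (expansions-size (1 + k))))

arcs-size : ∀ n → HasSize (ExpansionArc n) (arcCount n)
arcs-size = binaryInduction _ size-0 size-1+2* size-2+2*
  where
  size-0 : HasSize (ExpansionArc 0) 0
  size-0 = HasSize-cong (λ p → mk⇔ (λ ()) (expansionArcs-0 p)) HasSize-⊥

  size-1+2* : ∀ m → HasSize (ExpansionArc m) (arcCount m) → HasSize (ExpansionArc (1 + 2 * m)) (arcCount (1 + 2 * m))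
  size-1+2* m size-m = subst (HasSize _) (sym (arcCount-1+2* m))
    (HasSize-cong (λ p → ⇔.sym (expansionArcs-1+2* m p)) (HasSize-Image (appendBoth d1) (appendBoth-injective d1) size-m))

  size-2+2* : ∀ m → HasSize (ExpansionArc (1 + m)) (arcCount (1 + m)) → HasSize (ExpansionArc m) (arcCount m) →
              HasSize (ExpansionArc (2 + 2 * m)) (arcCount (2 + 2 * m))
  size-2+2* m size-1+m size-m = subst (HasSize _) (sym (arcCount-2+2* m))
    (HasSize-cong (λ p → ⇔.sym (expansionArcs-2+2* m p))
      (HasSize-⊎ disjoint-cross
        (HasSize-⊎ (λ { _ (_ , _ , refl) (_ , _ , eq) → d0≢d2 (∷ʳ-injectiveʳ _ _ (cong proj₁ eq)) })
          (HasSize-Image (appendBoth d0) (appendBoth-injective d0) size-1+m)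
          (HasSize-Image (appendBoth d2) (appendBoth-injective d2) size-m))
        (crossArcs-size m)))
    where
    disjoint-cross : ∀ p → Image (appendBoth d0) (ExpansionArc (1 + m)) p ⊎ Image (appendBoth d2) (ExpansionArc m) p →
                     CrossArc m p → ⊥
    disjoint-cross _ (inj₁ (_ , _ , refl)) (_ , _ , _ , _ , eq) = d0≢d2 (∷ʳ-injectiveʳ _ _ (cong proj₁ eq))
    disjoint-cross _ (inj₂ (_ , _ , refl)) (_ , _ , _ , _ , eq) = d0≢d2 (sym (∷ʳ-injectiveʳ _ _ (cong proj₂ eq)))

-- The cyclomatic number

vertexCount-positive : ∀ n → 0 < vertexCount n
vertexCount-positive = binaryInduction _ z<s
  (λ m pos → subst (0 <_) (sym (vertexCount-1+2* m)) pos)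
  (λ m _ pos → subst (0 <_) (sym (vertexCount-2+2* m)) (≤-trans pos (m≤n+m _ _)))

crossCount-positive : ∀ m → 0 < crossCount m
crossCount-positive m with binary m
... | zero   = z<s
... | 1+2* k = subst (0 <_) (sym (crossCount-1+2* k)) (vertexCount-positive k)
... | 2+2* k = subst (0 <_) (sym (crossCount-2+2* k)) (vertexCount-positive (1 + k))

private
  pred-crossCount : ∀ {m k} → pred (crossCount m) ≡ k → crossCount m ≡ suc k
  pred-crossCount {m} eq =
    trans (sym (suc-pred (crossCount m) {{>-nonZero (crossCount-positive m)}})) (cong suc eq)

  euler-step : ∀ e′ e x v′ v c′ c → e′ + 1 ≡ v′ + c′ → e + 1 ≡ v + c →
               e′ + e + suc x + 1 ≡ (v′ + v) + (c′ + c + x)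
  euler-step e′ e x v′ v c′ c eq′ eq = begin
    e′ + e + suc x + 1          ≡⟨ regroup e′ e x ⟩
    (e′ + 1) + (e + 1) + x      ≡⟨ cong₂ (λ a b → a + b + x) eq′ eq ⟩
    (v′ + c′) + (v + c) + x     ≡⟨ regroup′ v′ v c′ c x ⟩
    (v′ + v) + (c′ + c + x)     ∎
    where
    open ≡-Reasoning
    regroup : ∀ e′ e x → e′ + e + suc x + 1 ≡ (e′ + 1) + (e + 1) + x
    regroup = solve-∀
    regroup′ : ∀ v′ v c′ c x → (v′ + c′) + (v + c) + x ≡ (v′ + v) + (c′ + c + x)
    regroup′ = solve-∀

euler : ∀ n → arcCount n + 1 ≡ vertexCount n + cycleRank n
euler = binaryInduction _ refl euler-1+2* euler-2+2*
  where
  open ≡-Reasoning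
  euler-1+2* : ∀ m → arcCount m + 1 ≡ vertexCount m + cycleRank m →
               arcCount (1 + 2 * m) + 1 ≡ vertexCount (1 + 2 * m) + cycleRank (1 + 2 * m)
  euler-1+2* m eq = begin
    arcCount (1 + 2 * m) + 1                       ≡⟨ cong (_+ 1) (arcCount-1+2* m) ⟩
    arcCount m + 1                                 ≡⟨ eq ⟩
    vertexCount m + cycleRank m                    ≡⟨ sym (cong₂ _+_ (vertexCount-1+2* m) (cycleRank-1+2* m)) ⟩
    vertexCount (1 + 2 * m) + cycleRank (1 + 2 * m) ∎

  euler-2+2* : ∀ m → arcCount (1 + m) + 1 ≡ vertexCount (1 + m) + cycleRank (1 + m) →
               arcCount m + 1 ≡ vertexCount m + cycleRank m →
               arcCount (2 + 2 * m) + 1 ≡ vertexCount (2 + 2 * m) + cycleRank (2 + 2 * m)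
  euler-2+2* m eq′ eq = begin
    arcCount (2 + 2 * m) + 1
      ≡⟨ cong (_+ 1) (arcCount-2+2* m) ⟩
    arcCount (1 + m) + arcCount m + crossCount m + 1
      ≡⟨ cong (λ x → arcCount (1 + m) + arcCount m + x + 1) (pred-crossCount {m} refl) ⟩
    arcCount (1 + m) + arcCount m + suc (pred (crossCount m)) + 1
      ≡⟨ euler-step (arcCount (1 + m)) (arcCount m) (pred (crossCount m))
                    (vertexCount (1 + m)) (vertexCount m) (cycleRank (1 + m)) (cycleRank m) eq′ eq ⟩
    (vertexCount (1 + m) + vertexCount m) + (cycleRank (1 + m) + cycleRank m + pred (crossCount m))
      ≡⟨ sym (cong₂ _+_ (vertexCount-2+2* m) (cycleRank-2+2* m)) ⟩
    vertexCount (2 + 2 * m) + cycleRank (2 + 2 * m) ∎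

private
  +-≡1 : ∀ a b → a + b ≡ 1 → (a ≡ 1 × b ≡ 0) ⊎ (a ≡ 0 × b ≡ 1)
  +-≡1 zero          b eq = inj₂ (refl , eq)
  +-≡1 (suc zero)    b eq = inj₁ (refl , suc-injective eq)
  +-≡1 (suc (suc a)) b ()

  positive+positive≢1 : ∀ {a b} → 0 < a → 0 < b → a + b ≢ 1
  positive+positive≢1 {suc a} {suc b} _ _ eq with () ← m+n≡0⇒n≡0 a (suc-injective eq)

  positive+positive≡2 : ∀ {a b} → 0 < a → 0 < b → a + b ≡ 2 → a ≡ 1 × b ≡ 1
  positive+positive≡2 {1}           {1}           _ _ _ = refl , refl
  positive+positive≡2 {1}           {suc (suc b)} _ _ ()
  positive+positive≡2 {suc (suc a)} {suc b}       _ _ eq with () ← m+n≡0⇒n≡0 a (suc-injective (suc-injective eq))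

vertexCount≡1 : ∀ n → vertexCount n ≡ 1 → OddPart (suc n) 0
vertexCount≡1 = binaryInduction _ (λ _ → oddPart-self 0)
  (λ m ih eq → subst (λ x → OddPart x 0) (*-suc 2 m) (oddPart-2* (ih (trans (sym (vertexCount-1+2* m)) eq))))
  (λ m _ _ eq → ⊥-elim (positive+positive≢1 (vertexCount-positive (1 + m)) (vertexCount-positive m)
                                           (trans (sym (vertexCount-2+2* m)) eq)))

vertexCount≡2 : ∀ n → vertexCount n ≡ 2 → OddPart (suc n) 1
vertexCount≡2 = binaryInduction _ (λ ())
  (λ m ih eq → subst (λ x → OddPart x 1) (*-suc 2 m) (oddPart-2* (ih (trans (sym (vertexCount-1+2* m)) eq))))
  even
  where
  even : ∀ m → (vertexCount (1 + m) ≡ 2 → OddPart (2 + m) 1) → (vertexCount m ≡ 2 → OddPart (1 + m) 1) →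
         vertexCount (2 + 2 * m) ≡ 2 → OddPart (3 + 2 * m) 1
  even m _ _ eq
    with V′≡1 , V≡1 ← positive+positive≡2 (vertexCount-positive (1 + m)) (vertexCount-positive m)
                                         (trans (sym (vertexCount-2+2* m)) eq)
    with oddPart-neighbours (vertexCount≡1 m V≡1) (vertexCount≡1 (1 + m) V′≡1)
  ... | inj₁ (refl , _) = oddPart-self 1
  ... | inj₂ (_ , o)    = ⊥-elim (oddPart-0 o)

crossCount≡1 : ∀ m → crossCount m ≡ 1 → OddPart (1 + m) 0 ⊎ OddPart (2 + m) 0
crossCount≡1 m eq with binary m
... | zero   = inj₁ (oddPart-self 0)
... | 1+2* k = inj₁ (subst (λ x → OddPart x 0) (*-suc 2 k)
                       (oddPart-2* (vertexCount≡1 k (trans (sym (crossCount-1+2* k)) eq))))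
... | 2+2* k = inj₂ (subst (λ x → OddPart x 0) (trans (*-suc 2 (1 + k)) (cong (λ x → 2 + x) (*-suc 2 k)))
                       (oddPart-2* (vertexCount≡1 (1 + k) (trans (sym (crossCount-2+2* k)) eq))))

crossCount≡2 : ∀ m → crossCount m ≡ 2 →
               (∃ λ k → m ≡ 1 + 2 * k × OddPart (1 + k) 1) ⊎ (∃ λ k → m ≡ 2 + 2 * k × OddPart (2 + k) 1)
crossCount≡2 m eq with binary m
... | zero   with () ← eq
... | 1+2* k = inj₁ (k , refl , vertexCount≡2 k (trans (sym (crossCount-1+2* k)) eq))
... | 2+2* k = inj₂ (k , refl , vertexCount≡2 (1 + k) (trans (sym (crossCount-2+2* k)) eq))

cycleRank-2+2*≡0 : ∀ m → cycleRank (2 + 2 * m) ≡ 0 → crossCount m ≡ 1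
cycleRank-2+2*≡0 m eq = pred-crossCount {m} (m+n≡0⇒n≡0 (cycleRank (1 + m) + cycleRank m) (trans (sym (cycleRank-2+2* m)) eq))

cycleRank-2+2*≡1 : ∀ m → cycleRank (2 + 2 * m) ≡ 1 →
  ((cycleRank (1 + m) ≡ 1 × cycleRank m ≡ 0) ⊎ (cycleRank (1 + m) ≡ 0 × cycleRank m ≡ 1)) × crossCount m ≡ 1 ⊎
  cycleRank (1 + m) ≡ 0 × cycleRank m ≡ 0 × crossCount m ≡ 2
cycleRank-2+2*≡1 m eq with +-≡1 (cycleRank (1 + m) + cycleRank m) _ (trans (sym (cycleRank-2+2* m)) eq)
... | inj₁ (C′+C≡1 , X-1≡0) = inj₁ (+-≡1 _ _ C′+C≡1 , pred-crossCount {m} X-1≡0)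
... | inj₂ (C′+C≡0 , X-1≡1) = inj₂ (m+n≡0⇒m≡0 _ C′+C≡0 , m+n≡0⇒n≡0 _ C′+C≡0 , pred-crossCount {m} X-1≡1)

cycleRank≡1⇒family : ∀ n → cycleRank n ≡ 1 → Family (suc n)
cycleRank≡1⇒family = binaryInduction _ (λ ())
  (λ m ih eq → subst Family (*-suc 2 m) (family-2* (ih (trans (sym (cycleRank-1+2* m)) eq))))
  even
  where
  -- Either X(m) = 1 and a power of two sits next to a member of the family, or A(m + 1) and A(m)
  -- are trees and X(m) = 2, which leaves only n = 12 and n = 10.
  even : ∀ m → (cycleRank (1 + m) ≡ 1 → Family (2 + m)) → (cycleRank m ≡ 1 → Family (1 + m)) →
         cycleRank (2 + 2 * m) ≡ 1 → Family (3 + 2 * m)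
  even m ih′ ih eq with cycleRank-2+2*≡1 m eq
  ... | inj₁ (inj₁ (C′≡1 , _) , X≡1) with crossCount≡1 m X≡1
  ...   | inj₁ p = ⊥-elim (family-pred-not-pow2 p (ih′ C′≡1))
  ...   | inj₂ p = ⊥-elim (family-not-pow2 (ih′ C′≡1) p)
  even m ih′ ih eq | inj₁ (inj₂ (_ , C≡1) , X≡1) with crossCount≡1 m X≡1
  ...   | inj₁ p = ⊥-elim (family-not-pow2 (ih C≡1) p)
  ...   | inj₂ p = ⊥-elim (family-suc-not-pow2 (ih C≡1) p)
  even m ih′ ih eq | inj₂ (C′≡0 , C≡0 , X≡2) with crossCount≡2 m X≡2
  ...   | inj₁ (k , refl , o) with crossCount≡1 k (cycleRank-2+2*≡0 k C′≡0)
  ...     | inj₁ p with () ← oddPart-unique o p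
  ...     | inj₂ p with refl ← oddPart-3-below-pow2 o p = inj₂ (oddPart-self 6)
  even m ih′ ih eq | inj₂ (C′≡0 , C≡0 , X≡2) | inj₂ (k , refl , o) with crossCount≡1 k (cycleRank-2+2*≡0 k C≡0)
  ...     | inj₂ p with () ← oddPart-unique o p
  ...     | inj₁ p with refl ← pow2-below-oddPart-3 p o = inj₁ (oddPart-self 5)

family-induction : (P : ℕ → Set) → P 10 → P 12 → (∀ m → Family (suc m) → P m → P (1 + 2 * m)) →
                   ∀ n → Family (suc n) → P n
family-induction P P10 P12 step = binaryInduction _
  (λ f → ⊥-elim (family-not-pow2 f (oddPart-self 0)))
  (λ m ih f → let f′ = family-2*⁻ (subst Family (sym (*-suc 2 m)) f) in step m f′ (ih f′))
  even
  where
  even : ∀ m → (Family (2 + m) → P (1 + m)) → (Family (1 + m) → P m) → Family (3 + 2 * m) → P (2 + 2 * m)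
  even m _ _ f with subst Family (cong suc (sym (*-suc 2 m))) f
  ... | inj₁ o with refl ← suc-injective (oddPart-1+2* o) = P10
  ... | inj₂ o with refl ← suc-injective (oddPart-1+2* o) = P12

family⇒cycleRank≡1 : ∀ n → Family (suc n) → cycleRank n ≡ 1
family⇒cycleRank≡1 = family-induction (λ n → cycleRank n ≡ 1) refl refl
  (λ m _ eq → trans (cycleRank-1+2* m) eq)

-- Back to ℋ(n) and A(n)

expansion⇔hyp : ∀ {n} → n ≥ 1 → ∀ w → Expansion n w ⇔ Hyp n w
expansion⇔hyp (s≤s _) []      = mk⇔ (λ { (_ , ()) }) (λ { (() , _) })
expansion⇔hyp _       (_ ∷ _) = mk⇔ id id

expansionArc⇔arc : ∀ {n} → n ≥ 1 → ∀ p → ExpansionArc n p ⇔ Arc n p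
expansionArc⇔arc n≥1 (u , v) = mk⇔
  (λ (eu , ev , c) → to (expansion⇔hyp n≥1 u) eu , to (expansion⇔hyp n≥1 v) ev , c)
  (λ (hu , hv , c) → from (expansion⇔hyp n≥1 u) hu , from (expansion⇔hyp n≥1 v) hv , c)

integer-cyclomatic : ∀ {e v c} → e ℕ.+ 1 ≡ v ℕ.+ c → (+ e ℤ.- + v) ℤ.+ + 1 ≡ + c
integer-cyclomatic {e} {v} {c} eq = begin
  (+ e ℤ.- + v) ℤ.+ + 1      ≡⟨ regroup (+ e) (+ v) ⟩
  (+ e ℤ.+ + 1) ℤ.- + v      ≡⟨ cong (ℤ._- + v) (trans (sym (pos-+ e 1)) (trans (cong +_ eq) (pos-+ v c))) ⟩
  (+ v ℤ.+ + c) ℤ.- + v      ≡⟨ cancel (+ v) (+ c) ⟩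
  + c                        ∎
  where
  open ≡-Reasoning
  regroup : ∀ i j → (i ℤ.- j) ℤ.+ + 1 ≡ (i ℤ.+ + 1) ℤ.- j
  regroup = ℤ-Solver.solve-∀
  cancel : ∀ i j → (i ℤ.+ j) ℤ.- i ≡ j
  cancel = ℤ-Solver.solve-∀

isCyclomatic-1⇔cycleRank≡1 : ∀ n → n ≥ 1 → IsCyclomatic n (+ 1) ⇔ cycleRank n ≡ 1
isCyclomatic-1⇔cycleRank≡1 n n≥1 = mk⇔ ⇒ ⇐
  where
  vertices-size : HasSize (Hyp n) (vertexCount n)
  vertices-size = HasSize-cong (expansion⇔hyp n≥1) (expansions-size n)
  arcs-size′ : HasSize (Arc n) (arcCount n)
  arcs-size′ = HasSize-cong (expansionArc⇔arc n≥1) (arcs-size n)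
  ⇒ : IsCyclomatic n (+ 1) → cycleRank n ≡ 1
  ⇒ (_ , _ , V , E , eq)
    with refl ← HasSize-unique V vertices-size | refl ← HasSize-unique E arcs-size′ =
    sym (+-injective (trans eq (integer-cyclomatic (euler n))))
  ⇐ : cycleRank n ≡ 1 → IsCyclomatic n (+ 1)
  ⇐ C≡1 = _ , _ , vertices-size , arcs-size′ , sym (trans (integer-cyclomatic (euler n)) (cong +_ C≡1))

dropLast : Word → Word
dropLast = reverse ∘ drop 1 ∘ reverse

dropLast-∷ʳ : ∀ u d → dropLast (u ∷ʳ d) ≡ u
dropLast-∷ʳ u d = trans (cong (reverse ∘ drop 1) (reverse-++ u (d ∷ []))) (reverse-involutive u)

iso-refl : ∀ n → Iso n n
iso-refl n = record
  { to = id ; from = id ; to-hyp = λ _ h → h ; from-hyp = λ _ h → h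
  ; from-to = λ _ _ → refl ; to-from = λ _ _ → refl ; arcs = λ _ _ _ _ _ → mk⇔ id id }

iso-trans : ∀ {a b c} → Iso a b → Iso b c → Iso a c
iso-trans I J = record
  { to       = J.to ∘ I.to
  ; from     = I.from ∘ J.from
  ; to-hyp   = λ u h → J.to-hyp _ (I.to-hyp u h)
  ; from-hyp = λ v h → I.from-hyp _ (J.from-hyp v h)
  ; from-to  = λ u h → trans (cong I.from (J.from-to _ (I.to-hyp u h))) (I.from-to u h)
  ; to-from  = λ v h → trans (cong J.to (I.to-from _ (J.from-hyp v h))) (J.to-from v h)
  ; arcs     = λ u v hu hv c → ⇔.trans (I.arcs u v hu hv c) (J.arcs _ _ (I.to-hyp u hu) (I.to-hyp v hv) c)
  }
  where
  module I = Iso I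
  module J = Iso J

iso-1+2* : ∀ m → m ≥ 1 → Iso (1 + 2 * m) m
iso-1+2* m m≥1 = record
  { to = dropLast ; from = _∷ʳ d1 ; to-hyp = to-hyp ; from-hyp = from-hyp
  ; from-to = from-to ; to-from = λ v _ → dropLast-∷ʳ v d1 ; arcs = arcs }
  where
  split : ∀ {u} → Hyp (1 + 2 * m) u → Image (_∷ʳ d1) (Expansion m) u
  split {u} h = to (expansions-1+2* m u) (from (expansion⇔hyp (s≤s z≤n) u) h)

  to-hyp : ∀ u → Hyp (1 + 2 * m) u → Hyp m (dropLast u)
  to-hyp u h with x , e , refl ← split h = subst (Hyp m) (sym (dropLast-∷ʳ x d1)) (to (expansion⇔hyp m≥1 x) e)

  from-hyp : ∀ v → Hyp m v → Hyp (1 + 2 * m) (v ∷ʳ d1)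
  from-hyp v h = to (expansion⇔hyp (s≤s z≤n) _) (from (expansions-1+2* m _) (v , from (expansion⇔hyp m≥1 v) h , refl))

  from-to : ∀ u → Hyp (1 + 2 * m) u → dropLast u ∷ʳ d1 ≡ u
  from-to u h with x , _ , refl ← split h = cong (_∷ʳ d1) (dropLast-∷ʳ x d1)

  arcs : ∀ u v → Hyp (1 + 2 * m) u → Hyp (1 + 2 * m) v → ∀ c → Red c u v ⇔ Red c (dropLast u) (dropLast v)
  arcs u v hu hv c with x , _ , refl ← split hu | y , _ , refl ← split hv =
    subst₂ (λ x′ y′ → Red c (x ∷ʳ d1) (y ∷ʳ d1) ⇔ Red c x′ y′) (sym (dropLast-∷ʳ x d1)) (sym (dropLast-∷ʳ y d1))
      (red-∷ʳ⇔ (λ ()))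

family-suc⇒≥1 : ∀ {m} → Family (suc m) → m ≥ 1
family-suc⇒≥1 {zero}  f = ⊥-elim (family-not-pow2 f (oddPart-self 0))
family-suc⇒≥1 {suc m} _ = s≤s z≤n

inFamily⇔family : ∀ n → InFamily n ⇔ Family (suc n)
inFamily⇔family n = mk⇔
  (λ { (ℓ , inj₁ eq) → inj₁ (oddPart ℓ (trans (+-comm 1 n) eq))
     ; (ℓ , inj₂ eq) → inj₂ (oddPart ℓ (trans (+-comm 1 n) eq)) })
  (λ { (inj₁ (oddPart ℓ eq)) → ℓ , inj₁ (trans (+-comm n 1) eq)
     ; (inj₂ (oddPart ℓ eq)) → ℓ , inj₂ (trans (+-comm n 1) eq) })

family-iso : ∀ n → Family (suc n) → Iso n 10 ⊎ Iso n 12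
family-iso = family-induction (λ n → Iso n 10 ⊎ Iso n 12) (inj₁ (iso-refl 10)) (inj₂ (iso-refl 12))
  λ m f → Sum.map (iso-trans (iso-1+2* m (family-suc⇒≥1 f))) (iso-trans (iso-1+2* m (family-suc⇒≥1 f)))

mainTheorem2 : ∀ (n : ℕ) → n ≥ 1 →
    (IsCyclomatic n (+ 1) ⇔ InFamily n) ×
    (IsCyclomatic n (+ 1) → Iso n 10 ⊎ Iso n 12)
mainTheorem2 n n≥1 =
  mk⇔ (from (inFamily⇔family n) ∘ family) (from cyclomatic ∘ family⇒cycleRank≡1 n ∘ to (inFamily⇔family n)) ,
  family-iso n ∘ family
  where
  cyclomatic : IsCyclomatic n (+ 1) ⇔ cycleRank n ≡ 1
  cyclomatic = isCyclomatic-1⇔cycleRank≡1 n n≥1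
  family : IsCyclomatic n (+ 1) → Family (suc n)
  family = cycleRank≡1⇒family n ∘ to cyclomatic
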